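{- Let $T$ be the complete $q$-ary tree of depth $d$ ($q\ge 2$), let $S\subseteq V(T)$, let $i$ be a level, and let $u,v\in L_i$ be swappable in $S$. Suppose that for every $j<i$, the level $L_j$ is left-ordered in $S$. Then the treeswap $S'$ of $S$ between $u$ and $v$ satisfies $|S'|=|S|$ and $|\delta(S')|\le|\delta(S)|$.
   Context: The complete $q$-ary tree of depth $d$ is the rooted tree in which every vertex at distance less than $d$ from the root has exactly $q$ children, and vertices at distance $d$ are leaves. $L_i$ is the set of vertices at distance $i$ from the root. The children of a vertex $w$ are ordered $w^{(1)},\dots,w^{(q)}$; $\mathrm{children}(w)$ denotes the set of children, $\mathrm{Pa}(w)$ the parent, and $\mathrm{Desc}(w)$ the set of descendants of $w$ (vertices whose path to the root contains $w$; in particular $w\in\mathrm{Desc}(w)$). The vertices of $T$ are linearly ordered (breadth-first order) as follows: the root is first; every vertex of $L_i$ precedes every vertex of $L_j$ when $i<j$; within a level, if $x$ precedes $y$ then all children of $x$ precede all children of $y$; and $w^{(1)},\dots,w^{(q)}$ appear in this order. A vertex $x$ is to the left of $y$ if $x,y$ lie in the same level and $x$ precedes $y$. For $S\subseteq V(T)$, $\delta(S)=\{x\in V(T)\setminus S: N(x)\cap S\neq\emptyset\}$. Two vertices $u,v$ are swappable in $S$ if $u$ is to the left of $v$ and either (1) $u\notin S$ and $v\in S$, or (2) $u,v\notin S$, $\mathrm{children}(u)\cap S=\emptyset$ and $\mathrm{children}(v)\cap S\neq\emptyset$. Level $L_j$ is left-ordered in $S$ if it contains no pair of vertices swappable in $S$.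 For $u,v$ in the same level, list $\mathrm{Desc}(u)$ as $a_1,a_2,\dots$ and $\mathrm{Desc}(v)$ as $b_1,b_2,\dots$ in the breadth-first order (so $a_k\mapsto b_k$ is the natural isomorphism between the two subtrees). The treeswap of $S$ between $u$ and $v$ is the set $S'$ defined by: for $x\notin\mathrm{Desc}(u)\cup\mathrm{Desc}(v)$, $x\in S'$ iff $x\in S$; $b_k\in S'$ iff $a_k\in S$; and $a_k\in S'$ iff $b_k\in S$. -}

module Defs where

open import Data.Nat using (ℕ; zero; suc; _+_; _*_; _∸_; _^_; _≤_; _<_; _≡ᵇ_; _≤ᵇ_; _<ᵇ_)
open import Data.Bool using (Bool; true; false; _∧_; _∨_; not; if_then_else_)
open import Data.Product using (_×_)
open import Data.Sum using (_⊎_)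
open import Relation.Binary.PropositionalEquality using (_≡_)
open import Relation.Nullary using (¬_)

-- A vertex is a pair (i , k) with i ≤ d (its level) and k < q ^ i
-- (its position within level L_i, in breadth-first order, counted from 0).
-- The children of (i , k) (for i < d) are (suc i , q * k + c) for c < q,
-- in the order c = 0, 1, ..., q-1.  Hence the breadth-first order within
-- a level is the order of the index k, and "x is to the left of y" means
-- x < y for two indices of the same level.
--
-- A subset S ⊆ V(T) is represented by its characteristic function
-- S : ℕ → ℕ → Bool (vertex (i , k) ∈ S iff S i k ≡ true); values outside
-- the vertex range are irrelevant (never counted).

countᵇ : ℕ → (ℕ → Bool) → ℕ
countᵇ zero    f = 0
countᵇ (suc n) f = (if f n then 1 else 0) + countᵇ n f

anyᵇ : ℕ → (ℕ → Bool) → Bool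
anyᵇ zero    f = false
anyᵇ (suc n) f = f n ∨ anyᵇ n f

countV : (d q : ℕ) → (ℕ → ℕ → Bool) → ℕ
countV zero    q f = countᵇ (q ^ 0) (f 0)
countV (suc d) q f = countᵇ (q ^ suc d) (f (suc d)) + countV d q f

size : (d q : ℕ) → (ℕ → ℕ → Bool) → ℕ
size d q S = countV d q S

isChildIdx : (q p k : ℕ) → Bool
isChildIdx q p k = anyᵇ q (λ c → k ≡ᵇ q * p + c)

hasChildIn : (d q : ℕ) → (ℕ → ℕ → Bool) → ℕ → ℕ → Bool
hasChildIn d q S i a = (suc i ≤ᵇ d) ∧ anyᵇ q (λ c → S (suc i) (q * a + c))

parentIn : (q : ℕ) → (ℕ → ℕ → Bool) → ℕ → ℕ → Bool
parentIn q S zero    k = false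
parentIn q S (suc i) k = anyᵇ (q ^ i) (λ p → S i p ∧ isChildIdx q p k)

inDelta : (d q : ℕ) → (ℕ → ℕ → Bool) → ℕ → ℕ → Bool
inDelta d q S i k = not (S i k) ∧ (parentIn q S i k ∨ hasChildIn d q S i k)

deltaSize : (d q : ℕ) → (ℕ → ℕ → Bool) → ℕ
deltaSize d q S = countV d q (inDelta d q S)

Swappable : (d q : ℕ) → (ℕ → ℕ → Bool) → ℕ → ℕ → ℕ → Set
Swappable d q S i x y =
  x < y × y < q ^ i ×
  ( (S i x ≡ false × S i y ≡ true)
  ⊎ (S i x ≡ false × S i y ≡ false ×
     hasChildIn d q S i x ≡ false × hasChildIn d q S i y ≡ true) )

LeftOrdered : (d q : ℕ) → (ℕ → ℕ → Bool) → ℕ → Set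
LeftOrdered d q S j = ∀ x y → ¬ Swappable d q S j x y

inDescᵇ : (q i a j k : ℕ) → Bool
inDescᵇ q i a j k =
  (i ≤ᵇ j) ∧ ((a * q ^ (j ∸ i) ≤ᵇ k) ∧ (k <ᵇ suc a * q ^ (j ∸ i)))

-- The natural isomorphism Desc(u) → Desc(v) (k-th vertex in breadth-first
-- order to k-th vertex) sends (i + t , a * q^t + r) to (i + t , b * q^t + r).
treeswap : (q : ℕ) → (ℕ → ℕ → Bool) → (i a b : ℕ) → ℕ → ℕ → Bool
treeswap q S i a b j k =
  if inDescᵇ q i a j k then S j (b * q ^ (j ∸ i) + (k ∸ a * q ^ (j ∸ i)))
  else (if inDescᵇ q i b j k then S j (a * q ^ (j ∸ i) + (k ∸ b * q ^ (j ∸ i)))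
  else S j k)

module Submission where

-- On every level j the treeswap permutes vertex indices by an involution σⱼ (the identity above
-- level i, the exchange of the two blocks of descendants of u and v from level i on), and
-- S′ = S ∘ σ; hence |S′| = |S|.  For the boundary it suffices that x ∈ δ(S′) implies σ x ∈ δ(S).
-- Off the levels i − 1 and i this is an equivalence, because σ commutes with taking parents and
-- children.  At level i, position u of S′ carries v's membership and children; as v lies in S or
-- has a child in S, u ∈ δ(S′) forces v ∈ δ(S).  Position v keeps its parent Pa(v) although σ v = u
-- has parent Pa(u), which is Pa(v) or lies to its left; in the left-ordered level i − 1,
-- Pa(v) ∈ S implies Pa(u) ∈ S.  At level i − 1 only the children change, and the one vertex that
-- can gain a child in S′ is Pa(u) (when v ∈ S); left-orderedness shows that Pa(u) then lies in S
-- or already has a child in S, so it cannot newly enter δ.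

open import Defs
open import Data.Bool using (Bool; true; false; _∧_; _∨_; not; if_then_else_; T)
open import Data.Bool.Properties using (∨-zeroʳ; ∨-identityʳ; ∧-zeroʳ; ∧-identityʳ; if-float)
open import Data.Empty using (⊥-elim)
open import Data.Nat
  using (ℕ; zero; suc; _+_; _*_; _∸_; _^_; _≤_; _<_; _≤ᵇ_; _<ᵇ_; _≡ᵇ_; z≤n; s≤s; _≟_; _<?_; _≤?_)
open import Data.Nat.DivMod using (_/_; _%_; m≡m%n+[m/n]*n; m%n<n)
open import Data.Nat.Properties
open import Data.Nat.Tactic.RingSolver using (solve-∀)
open import Data.Product using (_×_; _,_; ∃; ∃₂; proj₁; proj₂)
open import Data.Sum using (_⊎_; inj₁; inj₂)
open import Data.Unit using (tt)
open import Function using (_∘_; id)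
open import Relation.Binary.Definitions using (tri<; tri≈; tri>)
open import Relation.Binary.PropositionalEquality
  using (_≡_; _≢_; refl; sym; trans; cong; cong₂; subst; subst₂; module ≡-Reasoning)
open import Relation.Nullary using (¬_; yes; no)

private
  variable
    a b c k m n p q r t : ℕ

bit : Bool → ℕ
bit b = if b then 1 else 0

bit-mono : ∀ {x y} → (x ≡ true → y ≡ true) → bit x ≤ bit y
bit-mono {false} _   = z≤n
bit-mono {true}  x⇒y rewrite x⇒y refl = ≤-refl

T⇒≡true : ∀ {x} → T x → x ≡ true
T⇒≡true {true} _ = refl

¬T⇒≡false : ∀ {x} → ¬ T x → x ≡ false
¬T⇒≡false {false} _ = refl
¬T⇒≡false {true}  ¬t = ⊥-elim (¬t tt)

≤ᵇ-true : m ≤ n → (m ≤ᵇ n) ≡ true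
≤ᵇ-true = T⇒≡true ∘ ≤⇒≤ᵇ

≤ᵇ-false : n < m → (m ≤ᵇ n) ≡ false
≤ᵇ-false n<m = ¬T⇒≡false (<⇒≱ n<m ∘ ≤ᵇ⇒≤ _ _)

<ᵇ-true : m < n → (m <ᵇ n) ≡ true
<ᵇ-true = T⇒≡true ∘ <⇒<ᵇ

<ᵇ-false : n ≤ m → (m <ᵇ n) ≡ false
<ᵇ-false n≤m = ¬T⇒≡false (λ m<n → <⇒≱ (<ᵇ⇒< _ _ m<n) n≤m)

≡ᵇ-refl : ∀ n → (n ≡ᵇ n) ≡ true
≡ᵇ-refl n = T⇒≡true (≡⇒≡ᵇ n n refl)

≡ᵇ-false : m ≢ n → (m ≡ᵇ n) ≡ false
≡ᵇ-false m≢n = ¬T⇒≡false (m≢n ∘ ≡ᵇ⇒≡ _ _)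

countᵇ-cong : ∀ n {f g : ℕ → Bool} → (∀ {k} → k < n → f k ≡ g k) → countᵇ n f ≡ countᵇ n g
countᵇ-cong zero    f≡g = refl
countᵇ-cong (suc n) f≡g = cong₂ _+_ (cong bit (f≡g ≤-refl)) (countᵇ-cong n (f≡g ∘ m<n⇒m<1+n))

countᵇ-mono : ∀ n {f g : ℕ → Bool} → (∀ {k} → k < n → f k ≡ true → g k ≡ true) →
  countᵇ n f ≤ countᵇ n g
countᵇ-mono zero    f⇒g = z≤n
countᵇ-mono (suc n) f⇒g = +-mono-≤ (bit-mono (f⇒g ≤-refl)) (countᵇ-mono n (f⇒g ∘ m<n⇒m<1+n))

countᵇ-update : ∀ n {f g : ℕ → Bool} {x} → x < n → (∀ {k} → k < n → k ≢ x → f k ≡ g k) →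
  countᵇ n f + bit (g x) ≡ countᵇ n g + bit (f x)
countᵇ-update (suc n) {f} {g} {x} x<1+n f≡g with n ≟ x
... | yes refl = begin
  bit (f n) + countᵇ n f + bit (g n) ≡⟨ cong (λ z → bit (f n) + z + bit (g n)) f≡g-below ⟩
  bit (f n) + countᵇ n g + bit (g n) ≡⟨ swap-ends (bit (f n)) (countᵇ n g) (bit (g n)) ⟩
  bit (g n) + countᵇ n g + bit (f n) ∎
  where
  open ≡-Reasoning
  f≡g-below : countᵇ n f ≡ countᵇ n g
  f≡g-below = countᵇ-cong n (λ k<n → f≡g (m<n⇒m<1+n k<n) (<⇒≢ k<n))
  swap-ends : ∀ x y z → x + y + z ≡ z + y + x
  swap-ends = solve-∀
... | no n≢x = begin
  bit (f n) + countᵇ n f + bit (g x)   ≡⟨ +-assoc (bit (f n)) _ _ ⟩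
  bit (f n) + (countᵇ n f + bit (g x)) ≡⟨ cong₂ _+_ (cong bit (f≡g ≤-refl n≢x)) ih ⟩
  bit (g n) + (countᵇ n g + bit (f x)) ≡⟨ +-assoc (bit (g n)) _ _ ⟨
  bit (g n) + countᵇ n g + bit (f x)   ∎
  where
  open ≡-Reasoning
  ih = countᵇ-update n (≤∧≢⇒< (≤-pred x<1+n) (n≢x ∘ sym)) (f≡g ∘ m<n⇒m<1+n)

countᵇ-involution : ∀ n (f : ℕ → Bool) {σ : ℕ → ℕ} →
  (∀ {k} → k < n → σ k < n) → (∀ {k} → k < n → σ (σ k) ≡ k) → countᵇ n (f ∘ σ) ≡ countᵇ n f
countᵇ-involution zero    f σ< σσ = refl
countᵇ-involution (suc n) f {σ} σ< σσ with σ n ≟ n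
... | yes σn≡n = cong₂ _+_ (cong (bit ∘ f) σn≡n) (countᵇ-involution n f σ<′ (σσ ∘ m<n⇒m<1+n))
  where
  σ<′ : k < n → σ k < n
  σ<′ k<n = ≤∧≢⇒< (≤-pred (σ< (m<n⇒m<1+n k<n)))
    (λ σk≡n → <⇒≢ k<n (trans (sym (σσ (m<n⇒m<1+n k<n))) (trans (cong σ σk≡n) σn≡n)))
... | no σn≢n = begin
  bit (f σn) + countᵇ n (f ∘ σ)     ≡⟨ +-comm (bit (f σn)) _ ⟩
  countᵇ n (f ∘ σ) + bit (f σn)     ≡⟨ cong (λ z → countᵇ n (f ∘ σ) + bit (f z)) (sym τσn≡σn) ⟩
  countᵇ n (f ∘ σ) + bit (f (τ σn)) ≡⟨ countᵇ-update n σn<n (λ _ k≢σn → cong f (sym (τk≡σk k≢σn))) ⟩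
  countᵇ n (f ∘ τ) + bit (f (σ σn)) ≡⟨ cong₂ (λ x z → x + bit (f z)) (countᵇ-involution n f τ< ττ) (σσ ≤-refl) ⟩
  countᵇ n f + bit (f n)            ≡⟨ +-comm _ (bit (f n)) ⟩
  bit (f n) + countᵇ n f            ∎
  where
  open ≡-Reasoning
  σn = σ n
  σn<n : σn < n
  σn<n = ≤∧≢⇒< (≤-pred (σ< ≤-refl)) σn≢n
  τ : ℕ → ℕ
  τ k = if k ≡ᵇ σn then σn else σ k
  τσn≡σn : τ σn ≡ σn
  τσn≡σn rewrite ≡ᵇ-refl σn = refl
  τk≡σk : k ≢ σn → τ k ≡ σ k
  τk≡σk k≢σn rewrite ≡ᵇ-false k≢σn = refl
  σσk≡k : k < n → σ (σ k) ≡ k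
  σσk≡k = σσ ∘ m<n⇒m<1+n
  τ< : k < n → τ k < n
  τ< {k} k<n with k ≟ σn
  ... | yes refl = subst (_< n) (sym τσn≡σn) σn<n
  ... | no k≢σn  = subst (_< n) (sym (τk≡σk k≢σn)) (≤∧≢⇒< (≤-pred (σ< (m<n⇒m<1+n k<n)))
                     (λ σk≡n → k≢σn (trans (sym (σσk≡k k<n)) (cong σ σk≡n))))
  ττ : k < n → τ (τ k) ≡ k
  ττ {k} k<n with k ≟ σn
  ... | yes refl = trans (cong τ τσn≡σn) τσn≡σn
  ... | no k≢σn  = trans (cong τ (τk≡σk k≢σn)) (trans (τk≡σk σk≢σn) (σσk≡k k<n))
    where
    σk≢σn : σ k ≢ σn
    σk≢σn σk≡σn = <⇒≢ k<n (trans (sym (σσk≡k k<n)) (trans (cong σ σk≡σn) (σσ ≤-refl)))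

countV-cong : ∀ d q {f g : ℕ → ℕ → Bool} →
  (∀ {j} → j ≤ d → countᵇ (q ^ j) (f j) ≡ countᵇ (q ^ j) (g j)) → countV d q f ≡ countV d q g
countV-cong zero    q f≡g = f≡g z≤n
countV-cong (suc d) q f≡g = cong₂ _+_ (f≡g ≤-refl) (countV-cong d q (f≡g ∘ m≤n⇒m≤1+n))

countV-mono : ∀ d q {f g : ℕ → ℕ → Bool} →
  (∀ {j} → j ≤ d → countᵇ (q ^ j) (f j) ≤ countᵇ (q ^ j) (g j)) → countV d q f ≤ countV d q g
countV-mono zero    q f≤g = f≤g z≤n
countV-mono (suc d) q f≤g = +-mono-≤ (f≤g ≤-refl) (countV-mono d q (f≤g ∘ m≤n⇒m≤1+n))

anyᵇ-cong : ∀ n {f g : ℕ → Bool} → (∀ {k} → k < n → f k ≡ g k) → anyᵇ n f ≡ anyᵇ n g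
anyᵇ-cong zero    f≡g = refl
anyᵇ-cong (suc n) f≡g = cong₂ _∨_ (f≡g ≤-refl) (anyᵇ-cong n (f≡g ∘ m<n⇒m<1+n))

anyᵇ-false : ∀ n {f : ℕ → Bool} → (∀ {k} → k < n → f k ≡ false) → anyᵇ n f ≡ false
anyᵇ-false zero    f≡false = refl
anyᵇ-false (suc n) f≡false rewrite f≡false ≤-refl = anyᵇ-false n (f≡false ∘ m<n⇒m<1+n)

anyᵇ-intro : ∀ n {f : ℕ → Bool} {k} → k < n → f k ≡ true → anyᵇ n f ≡ true
anyᵇ-intro (suc n) {f} {k} k<1+n fk with k ≟ n
... | yes refl rewrite fk = refl
... | no k≢n   = trans (cong (f n ∨_) (anyᵇ-intro n (≤∧≢⇒< (≤-pred k<1+n) k≢n) fk)) (∨-zeroʳ (f n))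

anyᵇ-elim : ∀ n {f : ℕ → Bool} → anyᵇ n f ≡ true → ∃ λ k → k < n × f k ≡ true
anyᵇ-elim (suc n) {f} any with f n in fn
... | true  = n , ≤-refl , fn
... | false with anyᵇ-elim n any
...   | k , k<n , fk = k , m<n⇒m<1+n k<n , fk

anyᵇ-unique : ∀ n {f : ℕ → Bool} {x} → x < n → (∀ {k} → k < n → k ≢ x → f k ≡ false) →
  anyᵇ n f ≡ f x
anyᵇ-unique (suc n) {f} {x} x<1+n others with n ≟ x
... | yes refl rewrite anyᵇ-false n (λ k<n → others (m<n⇒m<1+n k<n) (<⇒≢ k<n)) = ∨-identityʳ (f n)
... | no n≢x   rewrite others ≤-refl n≢x =
  anyᵇ-unique n (≤∧≢⇒< (≤-pred x<1+n) (n≢x ∘ sym)) (others ∘ m<n⇒m<1+n)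

child-< : c < q → m < n → q * m + c < q * n
child-< {c} {q} {m} {n} c<q m<n = begin-strict
  q * m + c <⟨ +-monoʳ-< (q * m) c<q ⟩
  q * m + q ≡⟨ +-comm (q * m) q ⟩
  q + q * m ≡⟨ *-suc q m ⟨
  q * suc m ≤⟨ *-monoʳ-≤ q m<n ⟩
  q * n     ∎
  where open ≤-Reasoning

child-injective : ∀ {c c′} → c < q → c′ < q → q * m + c ≡ q * p + c′ → m ≡ p
child-injective {q} {m} {p} {c} {c′} c<q c′<q eq with <-cmp m p
... | tri< m<p _ _ = ⊥-elim (<⇒≢ (<-≤-trans (child-< c<q m<p) (m≤m+n (q * p) c′)) eq)
... | tri≈ _ m≡p _ = m≡p
... | tri> _ _ p<m = ⊥-elim (<⇒≢ (<-≤-trans (child-< c′<q p<m) (m≤m+n (q * m) c)) (sym eq))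

child-<⇒parent-< : q * m + c < q * n → m < n
child-<⇒parent-< {q} {m} {c} {n} lt =
  ≰⇒> λ n≤m → <⇒≱ lt (≤-trans (*-monoʳ-≤ q n≤m) (m≤m+n (q * m) c))

child-<⇒parent-≤ : ∀ {c′} → c′ < q → q * m + c < q * p + c′ → m ≤ p
child-<⇒parent-≤ {q} {m} {c} {p} c′<q lt =
  ≮⇒≥ λ p<m → <⇒≱ lt (<⇒≤ (<-≤-trans (child-< c′<q p<m) (m≤m+n (q * m) c)))

child-decomposition : 0 < q → ∀ k → ∃₂ λ p c → c < q × k ≡ q * p + c
child-decomposition {suc q} _ k = k / suc q , k % suc q , m%n<n k (suc q) , (begin
  k                             ≡⟨ m≡m%n+[m/n]*n k (suc q) ⟩
  k % suc q + k / suc q * suc q ≡⟨ +-comm (k % suc q) _ ⟩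
  k / suc q * suc q + k % suc q ≡⟨ cong (_+ k % suc q) (*-comm (k / suc q) (suc q)) ⟩
  suc q * (k / suc q) + k % suc q ∎)
  where open ≡-Reasoning

inBlock : (t a k : ℕ) → Bool
inBlock t a k = (a * t ≤ᵇ k) ∧ (k <ᵇ suc a * t)

blockSwap : (t a b k : ℕ) → ℕ
blockSwap t a b k =
  if inBlock t a k then b * t + (k ∸ a * t)
  else if inBlock t b k then a * t + (k ∸ b * t)
  else k

Outside : (t a k : ℕ) → Set
Outside t a k = k < a * t ⊎ a * t + t ≤ k

data BlockPosition (t a : ℕ) : ℕ → Set where
  before : k < a * t → BlockPosition t a k
  inside : r < t → BlockPosition t a (a * t + r)
  after  : a * t + t ≤ k → BlockPosition t a k

blockPosition : ∀ t a k → BlockPosition t a k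
blockPosition t a k with k <? a * t
... | yes k<at = before k<at
... | no k≮at with k ∸ a * t <? t
...   | yes r<t = subst (BlockPosition t a) (m+[n∸m]≡n (≮⇒≥ k≮at)) (inside r<t)
...   | no r≮t  =
  after (subst (a * t + t ≤_) (m+[n∸m]≡n (≮⇒≥ k≮at)) (+-monoʳ-≤ (a * t) (≮⇒≥ r≮t)))

data BlockView (t a b : ℕ) : ℕ → Set where
  in-a    : r < t → BlockView t a b (a * t + r)
  in-b    : r < t → BlockView t a b (b * t + r)
  outside : Outside t a k → Outside t b k → BlockView t a b k

block-≤ : a < b → a * t + t ≤ b * t
block-≤ {a} {b} {t} a<b = subst (_≤ b * t) (+-comm t (a * t)) (*-monoˡ-≤ t a<b)

blockView : ∀ t {a b} k → a < b → BlockView t a b k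
blockView t {a} {b} k a<b with blockPosition t a k
... | before k<at = outside (inj₁ k<at) (inj₁ (<-≤-trans k<at (*-monoˡ-≤ t (<⇒≤ a<b))))
... | inside r<t  = in-a r<t
... | after at+t≤k with blockPosition t b k
...   | before k<bt = outside (inj₂ at+t≤k) (inj₁ k<bt)
...   | inside r<t  = in-b r<t
...   | after bt+t≤k = outside (inj₂ at+t≤k) (inj₂ bt+t≤k)

inBlock-inside : r < t → inBlock t a (a * t + r) ≡ true
inBlock-inside {r} {t} {a} r<t
  rewrite ≤ᵇ-true (m≤m+n (a * t) r)
        | <ᵇ-true (subst (a * t + r <_) (+-comm (a * t) t) (+-monoʳ-< (a * t) r<t)) = refl

inBlock-outside : Outside t a k → inBlock t a k ≡ false
inBlock-outside (inj₁ k<at) rewrite ≤ᵇ-false k<at = refl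
inBlock-outside {t} {a} {k} (inj₂ at+t≤k)
  rewrite <ᵇ-false (subst (_≤ k) (+-comm (a * t) t) at+t≤k) = ∧-zeroʳ _

blockSwap-a : ∀ t a b → r < t → blockSwap t a b (a * t + r) ≡ b * t + r
blockSwap-a {r} t a b r<t rewrite inBlock-inside {a = a} r<t | m+n∸m≡n (a * t) r = refl

blockSwap-b : ∀ t {a b} → a < b → r < t → blockSwap t a b (b * t + r) ≡ a * t + r
blockSwap-b {r} t {a} {b} a<b r<t
  rewrite inBlock-outside {t} {a} (inj₂ (≤-trans (block-≤ a<b) (m≤m+n (b * t) r)))
        | inBlock-inside {a = b} r<t | m+n∸m≡n (b * t) r = refl

blockSwap-outside : ∀ t a b → Outside t a k → Outside t b k → blockSwap t a b k ≡ k
blockSwap-outside {k} t a b out-a out-b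
  rewrite inBlock-outside {t} {a} {k} out-a | inBlock-outside {t} {b} {k} out-b = refl

blockSwap-involutive : ∀ t {a b} k → a < b → blockSwap t a b (blockSwap t a b k) ≡ k
blockSwap-involutive t {a} {b} k a<b with blockView t k a<b
... | in-a r<t = trans (cong (blockSwap t a b) (blockSwap-a t a b r<t)) (blockSwap-b t a<b r<t)
... | in-b r<t = trans (cong (blockSwap t a b) (blockSwap-b t a<b r<t)) (blockSwap-a t a b r<t)
... | outside out-a out-b = trans (cong (blockSwap t a b) fixed) fixed
  where fixed = blockSwap-outside t a b out-a out-b

block-< : b < n → r < t → b * t + r < n * t
block-< {b} {n} {r} {t} b<n r<t = begin-strict
  b * t + r <⟨ +-monoʳ-< (b * t) r<t ⟩
  b * t + t ≡⟨ +-comm (b * t) t ⟩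
  suc b * t ≤⟨ *-monoˡ-≤ t b<n ⟩
  n * t     ∎
  where open ≤-Reasoning

blockSwap-< : ∀ t {a b} k → a < b → b < n → k < n * t → blockSwap t a b k < n * t
blockSwap-< {n} t {a} {b} k a<b b<n k<nt with blockView t k a<b
... | in-a r<t = subst (_< n * t) (sym (blockSwap-a t a b r<t)) (block-< b<n r<t)
... | in-b r<t = subst (_< n * t) (sym (blockSwap-b t a<b r<t)) (block-< (<-trans a<b b<n) r<t)
... | outside out-a out-b = subst (_< n * t) (sym (blockSwap-outside t a b out-a out-b)) k<nt

outside-child : c < q → Outside t a m → Outside (q * t) a (q * m + c)
outside-child {c} {q} {t} {a} {m} c<q (inj₁ m<at) =
  inj₁ (subst (q * m + c <_) (comm q a t) (child-< c<q m<at))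
  where
  comm : ∀ q a t → q * (a * t) ≡ a * (q * t)
  comm = solve-∀
outside-child {c} {q} {t} {a} {m} c<q (inj₂ at+t≤m) = inj₂ (begin
  a * (q * t) + q * t ≡⟨ distrib q a t ⟩
  q * (a * t + t)     ≤⟨ *-monoʳ-≤ q at+t≤m ⟩
  q * m               ≤⟨ m≤m+n (q * m) c ⟩
  q * m + c           ∎)
  where
  open ≤-Reasoning
  distrib : ∀ q a t → a * (q * t) + q * t ≡ q * (a * t + t)
  distrib = solve-∀

regroup : ∀ q a t r c → q * (a * t + r) + c ≡ a * (q * t) + (q * r + c)
regroup = solve-∀

blockSwap-child : ∀ t {a b} m → a < b → c < q →
  blockSwap (q * t) a b (q * m + c) ≡ q * blockSwap t a b m + c
blockSwap-child {c} {q} t {a} {b} m a<b c<q with blockView t m a<b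
... | in-a {r} r<t = begin
  blockSwap (q * t) a b (q * (a * t + r) + c)       ≡⟨ cong (blockSwap (q * t) a b) (regroup q a t r c) ⟩
  blockSwap (q * t) a b (a * (q * t) + (q * r + c)) ≡⟨ blockSwap-a (q * t) a b (child-< c<q r<t) ⟩
  b * (q * t) + (q * r + c)                         ≡⟨ regroup q b t r c ⟨
  q * (b * t + r) + c                               ≡⟨ cong (λ z → q * z + c) (blockSwap-a t a b r<t) ⟨
  q * blockSwap t a b (a * t + r) + c               ∎
  where open ≡-Reasoning
... | in-b {r} r<t = begin
  blockSwap (q * t) a b (q * (b * t + r) + c)       ≡⟨ cong (blockSwap (q * t) a b) (regroup q b t r c) ⟩
  blockSwap (q * t) a b (b * (q * t) + (q * r + c)) ≡⟨ blockSwap-b (q * t) a<b (child-< c<q r<t) ⟩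
  a * (q * t) + (q * r + c)                         ≡⟨ regroup q a t r c ⟨
  q * (a * t + r) + c                               ≡⟨ cong (λ z → q * z + c) (blockSwap-b t a<b r<t) ⟨
  q * blockSwap t a b (b * t + r) + c               ∎
  where open ≡-Reasoning
... | outside out-a out-b = begin
  blockSwap (q * t) a b (q * m + c) ≡⟨ blockSwap-outside (q * t) a b
                                         (outside-child {a = a} c<q out-a) (outside-child {a = b} c<q out-b) ⟩
  q * m + c                         ≡⟨ cong (λ z → q * z + c) (blockSwap-outside t a b out-a out-b) ⟨
  q * blockSwap t a b m + c         ∎
  where open ≡-Reasoning

parentIn-child : ∀ (S : ℕ → ℕ → Bool) j → c < q → m < q ^ j → parentIn q S (suc j) (q * m + c) ≡ S j m
parentIn-child {c} {q} {m} S j c<q m<qʲ = begin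
  anyᵇ (q ^ j) (λ p → S j p ∧ isChildIdx q p (q * m + c)) ≡⟨ anyᵇ-unique (q ^ j) m<qʲ not-parent ⟩
  S j m ∧ isChildIdx q m (q * m + c)                       ≡⟨ cong (S j m ∧_) m-parent ⟩
  S j m ∧ true                                            ≡⟨ ∧-identityʳ (S j m) ⟩
  S j m                                                   ∎
  where
  open ≡-Reasoning
  m-parent : isChildIdx q m (q * m + c) ≡ true
  m-parent = anyᵇ-intro q c<q (≡ᵇ-refl (q * m + c))
  not-parent : p < q ^ j → p ≢ m → (S j p ∧ isChildIdx q p (q * m + c)) ≡ false
  not-parent {p} _ p≢m = trans
    (cong (S j p ∧_) (anyᵇ-false q (λ c′<q → ≡ᵇ-false (p≢m ∘ sym ∘ child-injective c<q c′<q))))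
    (∧-zeroʳ (S j p))

hasChildIn-intro : ∀ d (S : ℕ → ℕ → Bool) {j} → suc j ≤ d → c < q → S (suc j) (q * p + c) ≡ true →
  hasChildIn d q S j p ≡ true
hasChildIn-intro d S j<d c<q child∈S rewrite ≤ᵇ-true j<d = anyᵇ-intro _ c<q child∈S

hasChildIn-elim : ∀ d (S : ℕ → ℕ → Bool) j → hasChildIn d q S j p ≡ true →
  ∃ λ c → c < q × S (suc j) (q * p + c) ≡ true
hasChildIn-elim {q} d S j hc with suc j ≤ᵇ d
... | true = anyᵇ-elim q hc

hasChildIn-cong : ∀ d q (S S′ : ℕ → ℕ → Bool) j {p p′} →
  (∀ {c} → c < q → S (suc j) (q * p + c) ≡ S′ (suc j) (q * p′ + c)) →
  hasChildIn d q S j p ≡ hasChildIn d q S′ j p′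
hasChildIn-cong d q S S′ j children≡ = cong ((suc j ≤ᵇ d) ∧_) (anyᵇ-cong q children≡)

leftOrdered-member : ∀ d q (S : ℕ → ℕ → Bool) j → LeftOrdered d q S j →
  m ≤ n → n < q ^ j → S j n ≡ true → S j m ≡ true
leftOrdered-member {m} {n} d q S j lo m≤n n<qʲ n∈S with m ≟ n
... | yes refl = n∈S
... | no m≢n with S j m in m∈S
...   | true  = refl
...   | false = ⊥-elim (lo m n (≤∧≢⇒< m≤n m≢n , n<qʲ , inj₁ (m∈S , n∈S)))

leftOrdered-hasChild : ∀ d q (S : ℕ → ℕ → Bool) j → LeftOrdered d q S j →
  m ≤ n → n < q ^ j → S j m ≡ false → hasChildIn d q S j n ≡ true → hasChildIn d q S j m ≡ true
leftOrdered-hasChild {m} {n} d q S j lo m≤n n<qʲ m∉S hc-n with m ≟ n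
... | yes refl = hc-n
... | no m≢n with S j n in n∈S | hasChildIn d q S j m in hc-m
...   | _     | true  = refl
...   | true  | false = ⊥-elim (lo m n (≤∧≢⇒< m≤n m≢n , n<qʲ , inj₁ (m∉S , n∈S)))
...   | false | false = ⊥-elim (lo m n (≤∧≢⇒< m≤n m≢n , n<qʲ , inj₂ (m∉S , n∈S , hc-m , hc-n)))

boundary-mono : ∀ {s s′ x x′ y y′} →
  s′ ≡ s → (x′ ≡ true → x ≡ true) → (s ≡ false → y′ ≡ true → y ≡ true) →
  not s′ ∧ (x′ ∨ y′) ≡ true → not s ∧ (x ∨ y) ≡ true
boundary-mono {false} {x′ = true}                         refl x⇒ _ _ rewrite x⇒ refl = refl
boundary-mono {false} {x = x} {x′ = false} {y′ = true} refl _ y⇒ _ rewrite y⇒ refl refl = ∨-zeroʳ x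

boundary-from-child : ∀ {s s′ x x′ y y′} → s′ ≡ s → y′ ≡ y → s ≡ true ⊎ y ≡ true →
  not s′ ∧ (x′ ∨ y′) ≡ true → not s ∧ (x ∨ y) ≡ true
boundary-from-child {false} {x = x} refl refl (inj₂ refl) _ = ∨-zeroʳ x

boundary-cong : ∀ {s s′ x x′ y y′} → s′ ≡ s → x′ ≡ x → y′ ≡ y →
  not s′ ∧ (x′ ∨ y′) ≡ true → not s ∧ (x ∨ y) ≡ true
boundary-cong refl refl refl = id

treeswapIndex : (q i a b j k : ℕ) → ℕ
treeswapIndex q i a b j k = if i ≤ᵇ j then blockSwap (q ^ (j ∸ i)) a b k else k

treeswap≡ : ∀ q S i a b j k → treeswap q S i a b j k ≡ S j (treeswapIndex q i a b j k)
treeswap≡ q S i a b j k with i ≤ᵇ j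
... | false = refl
... | true  = sym (trans (if-float (S j) (inBlock w a k))
                         (cong (if inBlock w a k then S j (b * w + (k ∸ a * w)) else_)
                               (if-float (S j) (inBlock w b k))))
  where w = q ^ (j ∸ i)

^-split : ∀ q {i j} → i ≤ j → q ^ j ≡ q ^ i * q ^ (j ∸ i)
^-split q {i} i≤j = trans (cong (q ^_) (sym (m+[n∸m]≡n i≤j))) (^-distribˡ-+-* q i _)

outside-unit : k ≢ a → Outside 1 a k
outside-unit {k} {a} k≢a with <-cmp k a
... | tri< k<a _ _ = inj₁ (subst (k <_) (sym (*-identityʳ a)) k<a)
... | tri≈ _ k≡a _ = ⊥-elim (k≢a k≡a)
... | tri> _ _ a<k =
  inj₂ (subst (_≤ k) (+-comm 1 (a * 1)) (subst (λ z → suc z ≤ k) (sym (*-identityʳ a)) a<k))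

module Treeswap (d q : ℕ) (S : ℕ → ℕ → Bool) {i a b : ℕ} (a<b : a < b) (b<qⁱ : b < q ^ i) where

  S′ : ℕ → ℕ → Bool
  S′ = treeswap q S i a b

  σ : ℕ → ℕ → ℕ
  σ = treeswapIndex q i a b

  S′≡S∘σ : ∀ j k → S′ j k ≡ S j (σ j k)
  S′≡S∘σ = treeswap≡ q S i a b

  σ-below : ∀ {j} k → j < i → σ j k ≡ k
  σ-below k j<i rewrite ≤ᵇ-false j<i = refl

  σ-above : ∀ {j} k → i ≤ j → σ j k ≡ blockSwap (q ^ (j ∸ i)) a b k
  σ-above k i≤j rewrite ≤ᵇ-true i≤j = refl

  σ-< : ∀ j {k} → k < q ^ j → σ j k < q ^ j
  σ-< j {k} k<qʲ with i ≤? j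
  ... | no j≱i  = subst (_< q ^ j) (sym (σ-below k (≰⇒> j≱i))) k<qʲ
  ... | yes i≤j = subst₂ _<_ (sym (σ-above k i≤j)) (sym split)
                    (blockSwap-< (q ^ (j ∸ i)) k a<b b<qⁱ (subst (k <_) split k<qʲ))
    where split = ^-split q i≤j

  σ-involutive : ∀ j k → σ j (σ j k) ≡ k
  σ-involutive j k with i ≤? j
  ... | no j≱i  = trans (σ-below (σ j k) (≰⇒> j≱i)) (σ-below k (≰⇒> j≱i))
  ... | yes i≤j = trans (σ-above (σ j k) i≤j)
                    (trans (cong (blockSwap _ a b) (σ-above k i≤j)) (blockSwap-involutive _ k a<b))

  σ-child : ∀ {j} m → i ≤ j → c < q → σ (suc j) (q * m + c) ≡ q * σ j m + c
  σ-child {c} {j} m i≤j c<q = begin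
    σ (suc j) (q * m + c)                       ≡⟨ σ-above (q * m + c) (m≤n⇒m≤1+n i≤j) ⟩
    blockSwap (q ^ (suc j ∸ i)) a b (q * m + c) ≡⟨ cong (λ e → blockSwap (q ^ e) a b (q * m + c))
                                                        (+-∸-assoc 1 i≤j) ⟩
    blockSwap (q * q ^ (j ∸ i)) a b (q * m + c) ≡⟨ blockSwap-child (q ^ (j ∸ i)) m a<b c<q ⟩
    q * blockSwap (q ^ (j ∸ i)) a b m + c       ≡⟨ cong (λ z → q * z + c) (σ-above m i≤j) ⟨
    q * σ j m + c                               ∎
    where open ≡-Reasoning

  σ-level : ∀ k → σ i k ≡ blockSwap 1 a b k
  σ-level k = trans (σ-above k ≤-refl) (cong (λ e → blockSwap (q ^ e) a b k) (n∸n≡0 i))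

  σ-left : σ i a ≡ b
  σ-left = begin
    σ i a                       ≡⟨ σ-level a ⟩
    blockSwap 1 a b a           ≡⟨ cong (blockSwap 1 a b) (unit a) ⟨
    blockSwap 1 a b (a * 1 + 0) ≡⟨ blockSwap-a 1 a b (s≤s z≤n) ⟩
    b * 1 + 0                   ≡⟨ unit b ⟩
    b                           ∎
    where
    open ≡-Reasoning
    unit : ∀ x → x * 1 + 0 ≡ x
    unit x = trans (+-identityʳ (x * 1)) (*-identityʳ x)

  σ-right : σ i b ≡ a
  σ-right = trans (cong (σ i) (sym σ-left)) (σ-involutive i a)

  σ-fixes : ∀ {k} → k ≢ a → k ≢ b → σ i k ≡ k
  σ-fixes {k} k≢a k≢b = trans (σ-level k) (blockSwap-outside 1 a b (outside-unit k≢a) (outside-unit k≢b))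

  parentIn-below : ∀ {j} k → j ≤ i → parentIn q S′ j k ≡ parentIn q S j k
  parentIn-below {zero}  k _     = refl
  parentIn-below {suc j} k j<i = anyᵇ-cong (q ^ j) λ {p} _ →
    cong (_∧ isChildIdx q p k) (trans (S′≡S∘σ j p) (cong (S j) (σ-below p j<i)))

  parentIn-above : ∀ {j} m → i ≤ j → c < q → m < q ^ j →
    parentIn q S′ (suc j) (q * m + c) ≡ parentIn q S (suc j) (σ (suc j) (q * m + c))
  parentIn-above {c} {j} m i≤j c<q m<qʲ = begin
    parentIn q S′ (suc j) (q * m + c)            ≡⟨ parentIn-child S′ j c<q m<qʲ ⟩
    S′ j m                                      ≡⟨ S′≡S∘σ j m ⟩
    S j (σ j m)                                 ≡⟨ parentIn-child S j c<q (σ-< j m<qʲ) ⟨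
    parentIn q S (suc j) (q * σ j m + c)         ≡⟨ cong (parentIn q S (suc j)) (σ-child m i≤j c<q) ⟨
    parentIn q S (suc j) (σ (suc j) (q * m + c)) ∎
    where open ≡-Reasoning

  hasChildIn-below : ∀ {j} k → suc j < i → hasChildIn d q S′ j k ≡ hasChildIn d q S j k
  hasChildIn-below {j} k j+1<i = hasChildIn-cong d q S′ S j λ {c} _ →
    trans (S′≡S∘σ (suc j) (q * k + c)) (cong (S (suc j)) (σ-below (q * k + c) j+1<i))

  hasChildIn-above : ∀ {j} k → i ≤ j → hasChildIn d q S′ j k ≡ hasChildIn d q S j (σ j k)
  hasChildIn-above {j} k i≤j = hasChildIn-cong d q S′ S j λ {c} c<q →
    trans (S′≡S∘σ (suc j) (q * k + c)) (cong (S (suc j)) (σ-child k i≤j c<q))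

  treeswap-size : size d q S′ ≡ size d q S
  treeswap-size = countV-cong d q λ {j} _ → trans
    (countᵇ-cong (q ^ j) λ {k} _ → S′≡S∘σ j k)
    (countᵇ-involution (q ^ j) (S j) (σ-< j) (λ {k} _ → σ-involutive j k))

  treeswap-deltaSize : (∀ {j k} → k < q ^ j → inDelta d q S′ j k ≡ true → inDelta d q S j (σ j k) ≡ true) →
    deltaSize d q S′ ≤ deltaSize d q S
  treeswap-deltaSize transport = countV-mono d q λ {j} _ → begin
    countᵇ (q ^ j) (inDelta d q S′ j)           ≤⟨ countᵇ-mono (q ^ j) transport ⟩
    countᵇ (q ^ j) (inDelta d q S j ∘ σ j)      ≡⟨ countᵇ-involution (q ^ j) (inDelta d q S j)
                                                     (σ-< j) (λ {k} _ → σ-involutive j k) ⟩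
    countᵇ (q ^ j) (inDelta d q S j)            ∎
    where open ≤-Reasoning

module SwappableTreeswap (d q : ℕ) (0<q : 0 < q) (S : ℕ → ℕ → Bool) {i′ pu cu pv cv : ℕ}
  (cu<q : cu < q) (cv<q : cv < q) (i≤d : suc i′ ≤ d)
  (swappable : Swappable d q S (suc i′) (q * pu + cu) (q * pv + cv))
  (leftOrdered : LeftOrdered d q S i′) where

  i u v : ℕ
  i = suc i′
  u = q * pu + cu
  v = q * pv + cv

  u<v : u < v
  u<v = proj₁ swappable

  v<qⁱ : v < q ^ i
  v<qⁱ = proj₁ (proj₂ swappable)

  open Treeswap d q S {i = i} u<v v<qⁱ public

  u∉S : S i u ≡ false
  u∉S with proj₂ (proj₂ swappable)
  ... | inj₁ (u∉S , _) = u∉S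
  ... | inj₂ (u∉S , _) = u∉S

  v-occupied : S i v ≡ true ⊎ hasChildIn d q S i v ≡ true
  v-occupied with proj₂ (proj₂ swappable)
  ... | inj₁ (_ , v∈S)         = inj₁ v∈S
  ... | inj₂ (_ , _ , _ , hc-v) = inj₂ hc-v

  pu≤pv : pu ≤ pv
  pu≤pv = child-<⇒parent-≤ cv<q u<v

  pv<qⁱ′ : pv < q ^ i′
  pv<qⁱ′ = child-<⇒parent-< {q = q} v<qⁱ

  S′-at-v : S′ i v ≡ false
  S′-at-v = trans (S′≡S∘σ i v) (trans (cong (S i) σ-right) u∉S)

  S′⊆S-off-u : ∀ {k} → k ≢ u → S′ i k ≡ true → S i k ≡ true
  S′⊆S-off-u {k} k≢u k∈S′ with k ≟ v
  ... | no k≢v = trans (cong (S i) (sym (σ-fixes k≢u k≢v))) (trans (sym (S′≡S∘σ i k)) k∈S′)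
  ... | yes refl with subst (_≡ true) S′-at-v k∈S′
  ...   | ()

  hasChildIn-parent-level : ∀ {p} → S i′ p ≡ false →
    hasChildIn d q S′ i′ p ≡ true → hasChildIn d q S i′ p ≡ true
  hasChildIn-parent-level {p} p∉S hc′ with hasChildIn-elim d S′ i′ hc′
  ... | c , c<q , child∈S′ with q * p + c ≟ u
  ...   | no child≢u  = hasChildIn-intro d S i≤d c<q (S′⊆S-off-u child≢u child∈S′)
  ...   | yes child≡u = subst (λ x → hasChildIn d q S i′ x ≡ true) (sym p≡pu)
            (leftOrdered-hasChild d q S i′ leftOrdered pu≤pv pv<qⁱ′ pu∉S (hasChildIn-intro d S i≤d cv<q v∈S))
    where
    p≡pu : p ≡ pu
    p≡pu = child-injective c<q cu<q child≡u
    pu∉S : S i′ pu ≡ false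
    pu∉S = subst (λ x → S i′ x ≡ false) p≡pu p∉S
    v∈S : S i v ≡ true
    v∈S = trans (sym (trans (S′≡S∘σ i u) (cong (S i) σ-left))) (subst (λ x → S′ i x ≡ true) child≡u child∈S′)

  parentIn-σ : ∀ {k} → k ≢ u → parentIn q S i k ≡ true → parentIn q S i (σ i k) ≡ true
  parentIn-σ {k} k≢u par with k ≟ v
  ... | no k≢v   = subst (λ x → parentIn q S i x ≡ true) (sym (σ-fixes k≢u k≢v)) par
  ... | yes refl = begin
    parentIn q S i (σ i v) ≡⟨ cong (parentIn q S i) σ-right ⟩
    parentIn q S i u       ≡⟨ parentIn-child S i′ cu<q (≤-<-trans pu≤pv pv<qⁱ′) ⟩
    S i′ pu                ≡⟨ leftOrdered-member d q S i′ leftOrdered pu≤pv pv<qⁱ′ pv∈S ⟩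
    true                   ∎
    where
    open ≡-Reasoning
    pv∈S : S i′ pv ≡ true
    pv∈S = trans (sym (parentIn-child S i′ cv<q pv<qⁱ′)) par

  inDelta-transport-below : ∀ {j k} → j < i′ → inDelta d q S′ j k ≡ true → inDelta d q S j (σ j k) ≡ true
  inDelta-transport-below {j} {k} j<i′ = boundary-cong (S′≡S∘σ j k)
    (trans (parentIn-below k (<⇒≤ j<i)) (cong (parentIn q S j) (sym σk≡k)))
    (trans (hasChildIn-below k (s≤s j<i′)) (cong (hasChildIn d q S j) (sym σk≡k)))
    where
    j<i = m<n⇒m<1+n j<i′
    σk≡k = σ-below k j<i

  inDelta-transport-parent-level : ∀ {p} → inDelta d q S′ i′ p ≡ true → inDelta d q S i′ (σ i′ p) ≡ true
  inDelta-transport-parent-level {p} δ′ = subst (λ x → inDelta d q S i′ x ≡ true) (sym σp≡p)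
    (boundary-mono (trans (S′≡S∘σ i′ p) (cong (S i′) σp≡p))
      (subst (_≡ true) (parentIn-below p (n≤1+n i′))) hasChildIn-parent-level δ′)
    where σp≡p = σ-below p ≤-refl

  inDelta-transport-swap-level : ∀ {k} → inDelta d q S′ i k ≡ true → inDelta d q S i (σ i k) ≡ true
  inDelta-transport-swap-level {k} δ′ with k ≟ u
  ... | yes refl = subst (λ x → inDelta d q S i x ≡ true) (sym σ-left)
        (boundary-from-child (trans (S′≡S∘σ i u) (cong (S i) σ-left))
          (trans (hasChildIn-above u ≤-refl) (cong (hasChildIn d q S i) σ-left)) v-occupied δ′)
  ... | no k≢u = boundary-mono (S′≡S∘σ i k)
        (parentIn-σ k≢u ∘ subst (_≡ true) (parentIn-below k ≤-refl))
        (λ _ → subst (_≡ true) (hasChildIn-above k ≤-refl)) δ′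

  inDelta-transport-above : ∀ {j k} → i < j → k < q ^ j →
    inDelta d q S′ j k ≡ true → inDelta d q S j (σ j k) ≡ true
  inDelta-transport-above {suc j} {k} (s≤s i≤j) k<qʲ⁺¹ with child-decomposition 0<q k
  ... | m , c , c<q , refl = boundary-cong (S′≡S∘σ (suc j) (q * m + c))
        (parentIn-above m i≤j c<q (child-<⇒parent-< {q = q} k<qʲ⁺¹))
        (hasChildIn-above (q * m + c) (m≤n⇒m≤1+n i≤j))

  inDelta-transport : ∀ {j k} → k < q ^ j → inDelta d q S′ j k ≡ true → inDelta d q S j (σ j k) ≡ true
  inDelta-transport {j} k<qʲ with <-cmp j i′
  ... | tri< j<i′ _ _ = inDelta-transport-below j<i′
  ... | tri≈ _ refl _ = inDelta-transport-parent-level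
  ... | tri> _ _ i≤j with m≤n⇒m<n∨m≡n i≤j
  ...   | inj₁ i<j  = inDelta-transport-above i<j k<qʲ
  ...   | inj₂ refl = inDelta-transport-swap-level

treeswap-of-swappable : ∀ d q → 0 < q → (S : ℕ → ℕ → Bool) {i′ u v : ℕ} → suc i′ ≤ d →
  Swappable d q S (suc i′) u v → LeftOrdered d q S i′ →
  size d q (treeswap q S (suc i′) u v) ≡ size d q S ×
  deltaSize d q (treeswap q S (suc i′) u v) ≤ deltaSize d q S
treeswap-of-swappable d q 0<q S {u = u} {v} i≤d swappable leftOrdered
  with child-decomposition 0<q u | child-decomposition 0<q v
... | pu , cu , cu<q , refl | pv , cv , cv<q , refl = treeswap-size , treeswap-deltaSize inDelta-transport
  where open SwappableTreeswap d q 0<q S cu<q cv<q i≤d swappable leftOrdered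

lemma2p1 : (q d : ℕ) → 2 ≤ q → (S : ℕ → ℕ → Bool) → (i u v : ℕ) → i ≤ d →
    Swappable d q S i u v →
    (∀ j → j < i → LeftOrdered d q S j) →
    size d q (treeswap q S i u v) ≡ size d q S ×
    deltaSize d q (treeswap q S i u v) ≤ deltaSize d q S
lemma2p1 q d _    S zero     u v _   (u<v , v<1 , _) _ = ⊥-elim (n≮0 (<-≤-trans u<v (≤-pred v<1)))
lemma2p1 q d 2≤q S (suc i′) u v i≤d swappable leftOrdered =
  treeswap-of-swappable d q (<-≤-trans (s≤s z≤n) 2≤q) S i≤d swappable (leftOrdered i′ ≤-refl)
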